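{- $\mathcal{H}$ is computably stable: if $\mathcal{G}$ is a computable copy of $\mathcal{H}$, then every isomorphism from $\mathcal{H}$ to $\mathcal{G}$ is computable.
   Context: $\mathcal{H}=(H,\{D_i\}_{i<\omega},\{E_i\}_{i<\omega})$ is the computable structure with universe $H=[\omega]^{<\omega}\cup(\omega\times\{0,1\})$ (coded computably in $\omega$), where $[\omega]^{<\omega}$ is the set of finite subsets of $\omega$ (identified with characteristic functions, $X(i)\in\{0,1\}$). $E_i(X,Y)$ holds iff $X,Y\in[\omega]^{<\omega}$ and $X\triangle Y=\{i\}$. $D_i(X,(i,a))$ holds iff $X\in[\omega]^{<\omega}$ and $X(i)=a$; no other instances of these relations hold. -}

module Defs where

open import Data.Nat using (ℕ; zero; suc; _+_; _*_; _<_; _≡ᵇ_)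
open import Data.Nat.DivMod using (_/_; _%_)
open import Data.Bool using (Bool; true; false; if_then_else_)
open import Data.Fin using (Fin)
open import Data.Vec using (Vec; []; _∷_; lookup)
open import Data.Product using (Σ; _×_; _,_)
open import Relation.Binary.PropositionalEquality using (_≡_; _≢_)
open import Relation.Nullary using (¬_)
open import Function.Bundles using (_⇔_)
open import Function.Definitions using (Bijective)

data PR : ℕ → Set where
  zer  : ∀ {n} → PR n
  succ : PR 1
  proj : ∀ {n} → Fin n → PR n
  comp : ∀ {m n} → PR m → Vec (PR n) m → PR n
  prec : ∀ {n} → PR n → PR (suc (suc n)) → PR (suc n)
  mu   : ∀ {n} → PR (suc n) → PR n

mutual
  data Eval : ∀ {n} → PR n → Vec ℕ n → ℕ → Set where
    ev-zer  : ∀ {n} {xs : Vec ℕ n} → Eval zer xs 0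
    ev-succ : ∀ {x} → Eval succ (x ∷ []) (suc x)
    ev-proj : ∀ {n} {i : Fin n} {xs} → Eval (proj i) xs (lookup xs i)
    ev-comp : ∀ {m n} {f : PR m} {gs : Vec (PR n) m} {xs ys y} →
              EvalAll gs xs ys → Eval f ys y → Eval (comp f gs) xs y
    ev-prec0 : ∀ {n} {g : PR n} {h} {xs y} →
               Eval g xs y → Eval (prec g h) (0 ∷ xs) y
    ev-precS : ∀ {n} {g : PR n} {h} {k xs r y} →
               Eval (prec g h) (k ∷ xs) r → Eval h (k ∷ r ∷ xs) y →
               Eval (prec g h) (suc k ∷ xs) y
    ev-mu   : ∀ {n} {f : PR (suc n)} {xs y} →
              Eval f (y ∷ xs) 0 →
              (∀ z → z < y → Σ ℕ λ k → Eval f (z ∷ xs) (suc k)) →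
              Eval (mu f) xs y

  data EvalAll {n} : ∀ {m} → Vec (PR n) m → Vec ℕ n → Vec ℕ m → Set where
    [] : ∀ {xs} → EvalAll [] xs []
    _∷_ : ∀ {m} {g} {gs : Vec (PR n) m} {xs y ys} →
          Eval g xs y → EvalAll gs xs ys → EvalAll (g ∷ gs) xs (y ∷ ys)

Computable : (ℕ → ℕ) → Set
Computable f = Σ (PR 1) λ p → ∀ n → Eval p (n ∷ []) (f n)

bitℕ : Bool → ℕ
bitℕ b = if b then 1 else 0

ComputableRel : (ℕ → ℕ → ℕ → Set) → Set
ComputableRel R = Σ (PR 3) λ p → ∀ i x y →
  Σ Bool λ b → Eval p (i ∷ x ∷ y ∷ []) (bitℕ b) × ((b ≡ true) ⇔ R i x y)

record Structure : Set₁ where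
  field
    D : ℕ → ℕ → ℕ → Set
    E : ℕ → ℕ → ℕ → Set

open Structure public

ComputableStructure : Structure → Set
ComputableStructure 𝒜 = ComputableRel (D 𝒜) × ComputableRel (E 𝒜)

IsIso : Structure → Structure → (ℕ → ℕ) → Set
IsIso 𝒜 ℬ f = Bijective _≡_ _≡_ f
  × (∀ i x y → D 𝒜 i x y ⇔ D ℬ i (f x) (f y))
  × (∀ i x y → E 𝒜 i x y ⇔ E ℬ i (f x) (f y))

-- The structure ℋ, via a fixed computable coding of its universe in ω:
--   the finite set X with characteristic bits of n  ↦  2n
--   the pair (i , a) ∈ ω × {0,1}                    ↦  2(2i + a) + 1

isOdd : ℕ → Bool
isOdd n = (n % 2) ≡ᵇ 1

testBit : ℕ → ℕ → Bool
testBit n zero    = isOdd n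
testBit n (suc j) = testBit (n / 2) j

setCode : ℕ → ℕ
setCode n = 2 * n

pairCode : ℕ → Bool → ℕ
pairCode i a = suc (2 * (2 * i + bitℕ a))

HE : ℕ → ℕ → ℕ → Set
HE i x y = Σ ℕ λ n → Σ ℕ λ m → x ≡ setCode n × y ≡ setCode m ×
  (∀ j → (testBit n j ≢ testBit m j) ⇔ (j ≡ i))

HD : ℕ → ℕ → ℕ → Set
HD i x z = Σ ℕ λ n → Σ Bool λ a → x ≡ setCode n × z ≡ pairCode i a ×
  testBit n i ≡ a

ℋ : Structure
ℋ = record { D = HD ; E = HE }

module Submission where

-- The E_j-neighbour of a finite set X in ℋ is unique: it is X with its j-th
-- bit toggled. Hence f(X) is reached from f(∅) by toggling the bits of X one at
-- a time, each step being a search in the E-diagram of 𝒢 for the unique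
-- E_j-neighbour. Likewise (i, a) is the unique D_i-neighbour of any set whose
-- i-th bit is a, such as ∅ or {i}, so f(i, a) is found by a search in the
-- D-diagram of 𝒢. Every search halts because its witness exists and is unique.

open import Defs
open import Data.Bool using (Bool; true; false; not; if_then_else_)
open import Data.Bool.Properties using (not-¬; ¬-not; if-float) renaming (_≟_ to _≟ᵇ_)
open import Data.Fin using (zero; suc)
open import Data.Nat using (ℕ; _≡ᵇ_; zero; suc; _+_; _*_; _≤_; _<_; z≤n; s≤s)
open import Data.Nat.DivMod using (_/_; _%_; [m+kn]%n≡m%n; +-distrib-/-∣ʳ; m*n/n≡m)
open import Data.Nat.Divisibility using (divides)
open import Data.Nat.Properties
open import Data.Product using (_,_; proj₁; proj₂)
open import Data.Vec using (Vec; []; _∷_)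
open import Function.Base using (_∘_)
open import Function.Bundles using (_⇔_; mk⇔; Equivalence)
open import Function.Definitions using (Surjective)
open import Relation.Binary.PropositionalEquality
open import Relation.Nullary using (yes; no; contradiction)
open import Relation.Nullary.Decidable using (decidable-stable)

-- Parity and halving are defined by recursion on the successor so that the
-- programs parityP and halfP below compute them by prec.

parity : ℕ → Bool
parity zero    = false
parity (suc n) = not (parity n)

half : ℕ → ℕ
half zero    = zero
half (suc n) = half n + bitℕ (parity n)

n≡parity+2*half : ∀ n → n ≡ bitℕ (parity n) + 2 * half n
n≡parity+2*half zero = refl
n≡parity+2*half (suc n) with parity n | n≡parity+2*half n
... | false | n≡ = cong suc (trans n≡ (cong (2 *_) (sym (+-identityʳ (half n)))))
... | true  | n≡ = trans (cong suc n≡) (sym (trans (cong (2 *_) (+-comm (half n) 1)) (*-suc 2 (half n))))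

testBit-cons-zero : ∀ b q → testBit (bitℕ b + 2 * q) 0 ≡ b
testBit-cons-zero b q = trans
  (cong (_≡ᵇ 1) (trans (cong (λ m → (bitℕ b + m) % 2) (*-comm 2 q)) ([m+kn]%n≡m%n (bitℕ b) q 2)))
  (isOdd-bit b)
  where
  isOdd-bit : ∀ b → isOdd (bitℕ b) ≡ b
  isOdd-bit false = refl
  isOdd-bit true  = refl

testBit-cons-suc : ∀ b q j → testBit (bitℕ b + 2 * q) (suc j) ≡ testBit q j
testBit-cons-suc b q j = cong (λ m → testBit m j) (begin
  (bitℕ b + 2 * q) / 2  ≡⟨ +-distrib-/-∣ʳ (bitℕ b) (divides q (*-comm 2 q)) ⟩
  bitℕ b / 2 + 2 * q / 2 ≡⟨ cong₂ _+_ (bit/2≡0 b) (trans (cong (_/ 2) (*-comm 2 q)) (m*n/n≡m q 2)) ⟩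
  q                      ∎)
  where
  open ≡-Reasoning
  bit/2≡0 : ∀ b → bitℕ b / 2 ≡ 0
  bit/2≡0 false = refl
  bit/2≡0 true  = refl

testBit-zero : ∀ n → testBit n 0 ≡ parity n
testBit-zero n =
  trans (cong (λ m → testBit m 0) (n≡parity+2*half n)) (testBit-cons-zero (parity n) (half n))

testBit-suc : ∀ n j → testBit n (suc j) ≡ testBit (half n) j
testBit-suc n j =
  trans (cong (λ m → testBit m (suc j)) (n≡parity+2*half n)) (testBit-cons-suc (parity n) (half n) j)

testBit-∅ : ∀ j → testBit 0 j ≡ false
testBit-∅ zero    = refl
testBit-∅ (suc j) = trans (testBit-suc 0 j) (testBit-∅ j)

half-suc≤ : ∀ n → half (suc n) ≤ n
half-suc≤ zero    = z≤n
half-suc≤ (suc n) =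
  ≤-trans (+-mono-≤ (half-suc≤ n) (bit≤1 (parity (suc n)))) (≤-reflexive (+-comm n 1))
  where
  bit≤1 : ∀ b → bitℕ b ≤ 1
  bit≤1 false = z≤n
  bit≤1 true  = s≤s z≤n

half-≤ : ∀ {n k} → n ≤ suc k → half n ≤ k
half-≤ {zero}  _         = z≤n
half-≤ {suc n} (s≤s n≤k) = ≤-trans (half-suc≤ n) n≤k

testBit-≥ : ∀ n k → n ≤ k → testBit n k ≡ false
testBit-≥ n zero    z≤n = refl
testBit-≥ n (suc k) n≤k = trans (testBit-suc n k) (testBit-≥ (half n) k (half-≤ n≤k))

testBit-injective : ∀ {a b} → (∀ k → testBit a k ≡ testBit b k) → a ≡ b
testBit-injective {a} {b} = bounded (a + b) (m≤m+n a b) (m≤n+m b a)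
  where
  open ≡-Reasoning
  bounded : ∀ k {a b} → a ≤ k → b ≤ k → (∀ j → testBit a j ≡ testBit b j) → a ≡ b
  bounded zero    z≤n z≤n _ = refl
  bounded (suc k) {a} {b} a≤ b≤ same = begin
    a                               ≡⟨ n≡parity+2*half a ⟩
    bitℕ (parity a) + 2 * half a    ≡⟨ cong₂ (λ p h → bitℕ p + 2 * h) parity-eq half-eq ⟩
    bitℕ (parity b) + 2 * half b    ≡⟨ n≡parity+2*half b ⟨
    b                               ∎
    where
    parity-eq : parity a ≡ parity b
    parity-eq = trans (sym (testBit-zero a)) (trans (same 0) (testBit-zero b))
    half-eq : half a ≡ half b
    half-eq = bounded k (half-≤ a≤) (half-≤ b≤)
      (λ j → trans (sym (testBit-suc a j)) (trans (same (suc j)) (testBit-suc b j)))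

toggle : ℕ → ℕ → ℕ
toggle n zero    = bitℕ (not (parity n)) + 2 * half n
toggle n (suc j) = bitℕ (parity n) + 2 * toggle (half n) j

testBit-toggle-≡ : ∀ n j → testBit (toggle n j) j ≡ not (testBit n j)
testBit-toggle-≡ n zero =
  trans (testBit-cons-zero (not (parity n)) (half n)) (cong not (sym (testBit-zero n)))
testBit-toggle-≡ n (suc j) =
  trans (testBit-cons-suc (parity n) (toggle (half n) j) j)
        (trans (testBit-toggle-≡ (half n) j) (cong not (sym (testBit-suc n j))))

testBit-toggle-≢ : ∀ n j k → k ≢ j → testBit (toggle n j) k ≡ testBit n k
testBit-toggle-≢ n zero    zero    k≢j = contradiction refl k≢j
testBit-toggle-≢ n zero    (suc k) _   =
  trans (testBit-cons-suc (not (parity n)) (half n) k) (sym (testBit-suc n k))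
testBit-toggle-≢ n (suc j) zero    _   =
  trans (testBit-cons-zero (parity n) (toggle (half n) j)) (sym (testBit-zero n))
testBit-toggle-≢ n (suc j) (suc k) k≢j =
  trans (testBit-cons-suc (parity n) (toggle (half n) j) k)
        (trans (testBit-toggle-≢ (half n) j k (k≢j ∘ cong suc)) (sym (testBit-suc n k)))

prefix : ℕ → ℕ → ℕ
prefix n zero    = 0
prefix n (suc j) = if testBit n j then toggle (prefix n j) j else prefix n j

testBit-prefix-≥ : ∀ n {j k} → j ≤ k → testBit (prefix n j) k ≡ false
testBit-prefix-≥ n {zero}  {k} _ = testBit-∅ k
testBit-prefix-≥ n {suc j} {k} j<k with testBit n j
... | true  = trans (testBit-toggle-≢ (prefix n j) j k (λ k≡j → <-irrefl (sym k≡j) j<k))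
                    (testBit-prefix-≥ n (<⇒≤ j<k))
... | false = testBit-prefix-≥ n (<⇒≤ j<k)

testBit-prefix-suc-≡ : ∀ n j → testBit (prefix n (suc j)) j ≡ testBit n j
testBit-prefix-suc-≡ n j with testBit n j
... | true  = trans (testBit-toggle-≡ (prefix n j) j) (cong not (testBit-prefix-≥ n {j} ≤-refl))
... | false = testBit-prefix-≥ n {j} ≤-refl

testBit-prefix-suc-≢ : ∀ n j k → k ≢ j → testBit (prefix n (suc j)) k ≡ testBit (prefix n j) k
testBit-prefix-suc-≢ n j k k≢j with testBit n j
... | true  = testBit-toggle-≢ (prefix n j) j k k≢j
... | false = refl

testBit-prefix-< : ∀ n {j k} → k < j → testBit (prefix n j) k ≡ testBit n k
testBit-prefix-< n {suc j} {k} k<1+j with k ≟ j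
... | yes refl = testBit-prefix-suc-≡ n k
... | no  k≢j  = trans (testBit-prefix-suc-≢ n j k k≢j)
                       (testBit-prefix-< n (≤∧≢⇒< (≤-pred k<1+j) k≢j))

prefix-self : ∀ n → prefix n n ≡ n
prefix-self n = testBit-injective same
  where
  same : ∀ k → testBit (prefix n n) k ≡ testBit n k
  same k with k <? n
  ... | yes k<n = testBit-prefix-< n k<n
  ... | no  k≮n = trans (testBit-prefix-≥ n (≮⇒≥ k≮n)) (sym (testBit-≥ n k (≮⇒≥ k≮n)))

setCode-injective : ∀ {m n} → setCode m ≡ setCode n → m ≡ n
setCode-injective {m} {n} = *-cancelˡ-≡ m n 2

HE-toggle : ∀ n j → HE j (setCode n) (setCode (toggle n j))
HE-toggle n j = n , toggle n j , refl , refl , λ k → mk⇔ (differs⇒≡ k) (≡⇒differs k)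
  where
  differs⇒≡ : ∀ k → testBit n k ≢ testBit (toggle n j) k → k ≡ j
  differs⇒≡ k differs with k ≟ j
  ... | yes k≡j = k≡j
  ... | no  k≢j = contradiction (sym (testBit-toggle-≢ n j k k≢j)) differs
  ≡⇒differs : ∀ k → k ≡ j → testBit n k ≢ testBit (toggle n j) k
  ≡⇒differs k refl eq = not-¬ refl (trans eq (testBit-toggle-≡ n k))

toggle-unique : ∀ {n m j} → (∀ k → (testBit n k ≢ testBit m k) ⇔ (k ≡ j)) → m ≡ toggle n j
toggle-unique {n} {m} {j} differs⇔ = testBit-injective same
  where
  same : ∀ k → testBit m k ≡ testBit (toggle n j) k
  same k with k ≟ j
  ... | yes refl =
    trans (¬-not (≢-sym (Equivalence.from (differs⇔ k) refl))) (sym (testBit-toggle-≡ n k))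
  ... | no  k≢j  =
    trans (sym (decidable-stable (testBit n k ≟ᵇ testBit m k) (k≢j ∘ Equivalence.to (differs⇔ k))))
          (sym (testBit-toggle-≢ n j k k≢j))

HE-functional : ∀ {j x y y′} → HE j x y → HE j x y′ → y ≡ y′
HE-functional (n , m , refl , refl , differs⇔) (n′ , m′ , x≡ , refl , differs⇔′)
  with setCode-injective {n} {n′} x≡
... | refl = cong setCode (trans (toggle-unique differs⇔) (sym (toggle-unique differs⇔′)))

HD-testBit : ∀ n i → HD i (setCode n) (pairCode i (testBit n i))
HD-testBit n i = n , testBit n i , refl , refl , refl

HD-functional : ∀ {i x z z′} → HD i x z → HD i x z′ → z ≡ z′
HD-functional (n , a , refl , refl , refl) (n′ , a′ , x≡ , refl , refl)
  with setCode-injective {n} {n′} x≡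
... | refl = refl

constP : ∀ {n} → ℕ → PR n
constP zero    = zer
constP (suc c) = comp succ (constP c ∷ [])

eval-constP : ∀ {n} c {xs : Vec ℕ n} → Eval (constP c) xs c
eval-constP zero    = ev-zer
eval-constP (suc c) = ev-comp (eval-constP c ∷ []) ev-succ

notP : PR 1
notP = prec (constP 1) zer

eval-notP : ∀ b → Eval notP (bitℕ b ∷ []) (bitℕ (not b))
eval-notP false = ev-prec0 (eval-constP 1)
eval-notP true  = ev-precS (ev-prec0 (eval-constP 1)) ev-zer

parityP : PR 1
parityP = prec zer (comp notP (proj (suc zero) ∷ []))

eval-parityP : ∀ n → Eval parityP (n ∷ []) (bitℕ (parity n))
eval-parityP zero    = ev-prec0 ev-zer
eval-parityP (suc n) = ev-precS (eval-parityP n) (ev-comp (ev-proj ∷ []) (eval-notP (parity n)))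

addP : PR 2
addP = prec (proj zero) (comp succ (proj (suc zero) ∷ []))

eval-addP : ∀ m n → Eval addP (m ∷ n ∷ []) (m + n)
eval-addP zero    n = ev-prec0 ev-proj
eval-addP (suc m) n = ev-precS (eval-addP m n) (ev-comp (ev-proj ∷ []) ev-succ)

halfP : PR 1
halfP = prec zer (comp addP (proj (suc zero) ∷ comp parityP (proj zero ∷ []) ∷ []))

eval-halfP : ∀ n → Eval halfP (n ∷ []) (half n)
eval-halfP zero    = ev-prec0 ev-zer
eval-halfP (suc n) = ev-precS (eval-halfP n)
  (ev-comp (ev-proj ∷ ev-comp (ev-proj ∷ []) (eval-parityP n) ∷ [])
           (eval-addP (half n) (bitℕ (parity n))))

halves : ℕ → ℕ → ℕ
halves zero    n = n
halves (suc j) n = half (halves j n)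

halves-half : ∀ j n → halves j (half n) ≡ half (halves j n)
halves-half zero    n = refl
halves-half (suc j) n = cong half (halves-half j n)

testBit≡parity∘halves : ∀ n j → testBit n j ≡ parity (halves j n)
testBit≡parity∘halves n zero    = testBit-zero n
testBit≡parity∘halves n (suc j) =
  trans (testBit-suc n j) (trans (testBit≡parity∘halves (half n) j) (cong parity (halves-half j n)))

halvesP : PR 2
halvesP = prec (proj zero) (comp halfP (proj (suc zero) ∷ []))

eval-halvesP : ∀ j n → Eval halvesP (j ∷ n ∷ []) (halves j n)
eval-halvesP zero    n = ev-prec0 ev-proj
eval-halvesP (suc j) n = ev-precS (eval-halvesP j n) (ev-comp (ev-proj ∷ []) (eval-halfP (halves j n)))

testBitP : PR 2
testBitP = comp parityP (halvesP ∷ [])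

eval-testBitP : ∀ j n → Eval testBitP (j ∷ n ∷ []) (bitℕ (testBit n j))
eval-testBitP j n rewrite testBit≡parity∘halves n j =
  ev-comp (eval-halvesP j n ∷ []) (eval-parityP (halves j n))

ifP : PR 3
ifP = prec (proj (suc zero)) (proj (suc (suc zero)))

eval-ifP : ∀ b x y → Eval ifP (bitℕ b ∷ x ∷ y ∷ []) (if b then x else y)
eval-ifP false x y = ev-prec0 ev-proj
eval-ifP true  x y = ev-precS (ev-prec0 ev-proj) ev-proj

-- The least y with p(i, x, y) = 1; μ searches for a zero, hence the notP.
searchP : PR 3 → PR 2
searchP p = mu (comp notP (comp p (proj (suc zero) ∷ proj (suc (suc zero)) ∷ proj zero ∷ []) ∷ []))

eval-searchP-unique : ∀ {R : ℕ → ℕ → ℕ → Set} (cR : ComputableRel R) {i x y} →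
  R i x y → (∀ z → R i x z → z ≡ y) → Eval (searchP (proj₁ cR)) (i ∷ x ∷ []) y
eval-searchP-unique {R} (p , p-decides) {i} {x} {y} r unique = ev-mu found (λ z z<y → 0 , rejected z z<y)
  where
  eval-body : ∀ z b → Eval p (i ∷ x ∷ z ∷ []) (bitℕ b) →
    Eval (comp notP (comp p (proj (suc zero) ∷ proj (suc (suc zero)) ∷ proj zero ∷ []) ∷ []))
         (z ∷ i ∷ x ∷ []) (bitℕ (not b))
  eval-body z b p-eval =
    ev-comp (ev-comp (ev-proj ∷ ev-proj ∷ ev-proj ∷ []) p-eval ∷ []) (eval-notP b)
  found : Eval _ (y ∷ i ∷ x ∷ []) 0
  found with p-decides i x y
  ... | true  , p-eval , _   = eval-body y true p-eval
  ... | false , _      , b⇔R = contradiction (Equivalence.from b⇔R r) λ ()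
  rejected : ∀ z → z < y → Eval _ (z ∷ i ∷ x ∷ []) 1
  rejected z z<y with p-decides i x z
  ... | false , p-eval , _   = eval-body z false p-eval
  ... | true  , _      , b⇔R = contradiction (unique z (Equivalence.to b⇔R refl)) (<⇒≢ z<y)

eval-searchP-along : ∀ {R S : ℕ → ℕ → ℕ → Set} (cS : ComputableRel S) {f : ℕ → ℕ} →
  Surjective _≡_ _≡_ f → (∀ i x y → R i x y ⇔ S i (f x) (f y)) →
  (∀ {i x y y′} → R i x y → R i x y′ → y ≡ y′) →
  ∀ {i x y} → R i x y → Eval (searchP (proj₁ cS)) (i ∷ f x ∷ []) (f y)
eval-searchP-along {S = S} cS {f} surjective R⇔S functional {i} {x} {y} r =
  eval-searchP-unique cS (Equivalence.to (R⇔S i x y) r) unique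
  where
  unique : ∀ z → S i (f x) z → z ≡ f y
  unique z s with surjective z
  ... | w , fw≡z = trans (sym (fw≡z refl)) (cong f (functional (Equivalence.from (R⇔S i x w) s′) r))
    where
    s′ : S i (f x) (f w)
    s′ = subst (S i (f x)) (sym (fw≡z refl)) s

setWithBit : ℕ → Bool → ℕ
setWithBit i a = if a then toggle 0 i else 0

testBit-setWithBit : ∀ i a → testBit (setWithBit i a) i ≡ a
testBit-setWithBit i true  = trans (testBit-toggle-≡ 0 i) (cong not (testBit-∅ i))
testBit-setWithBit i false = testBit-∅ i

n≡pairCode-or-setCode : ∀ n →
  n ≡ (if parity n then pairCode (half (half n)) (parity (half n)) else setCode (half n))
n≡pairCode-or-setCode n with parity n | n≡parity+2*half n
... | true  | n≡ = trans n≡ (cong (λ h → suc (2 * h)) half-n≡)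
  where
  half-n≡ : half n ≡ 2 * half (half n) + bitℕ (parity (half n))
  half-n≡ = trans (n≡parity+2*half (half n)) (+-comm (bitℕ (parity (half n))) (2 * half (half n)))
... | false | n≡ = n≡

module Reconstruction (𝒢 : Structure) (cD : ComputableRel (D 𝒢)) (cE : ComputableRel (E 𝒢))
                      (f : ℕ → ℕ) (iso : IsIso ℋ 𝒢 f) where

  private
    surjective = proj₂ (proj₁ iso)
    preserves-D = proj₁ (proj₂ iso)
    preserves-E = proj₂ (proj₂ iso)

  toggleP : PR 2
  toggleP = searchP (proj₁ cE)

  eval-toggleP : ∀ j n → Eval toggleP (j ∷ f (setCode n) ∷ []) (f (setCode (toggle n j)))
  eval-toggleP j n = eval-searchP-along cE surjective preserves-E HE-functional (HE-toggle n j)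

  prefixP : PR 2
  prefixP = prec (constP (f 0))
    (comp ifP (comp testBitP (proj zero ∷ proj (suc (suc zero)) ∷ [])
             ∷ comp toggleP (proj zero ∷ proj (suc zero) ∷ [])
             ∷ proj (suc zero) ∷ []))

  eval-prefixP : ∀ j n → Eval prefixP (j ∷ n ∷ []) (f (setCode (prefix n j)))
  eval-prefixP zero    n = ev-prec0 (eval-constP (f 0))
  eval-prefixP (suc j) n = ev-precS (eval-prefixP j n)
    (subst (Eval _ _) (sym (if-float (f ∘ setCode) (testBit n j)))
      (ev-comp (ev-comp (ev-proj ∷ ev-proj ∷ []) (eval-testBitP j n)
              ∷ ev-comp (ev-proj ∷ ev-proj ∷ []) (eval-toggleP j (prefix n j))
              ∷ ev-proj ∷ [])
        (eval-ifP (testBit n j) _ _)))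

  setCodeP : PR 1
  setCodeP = comp prefixP (proj zero ∷ proj zero ∷ [])

  eval-setCodeP : ∀ n → Eval setCodeP (n ∷ []) (f (setCode n))
  eval-setCodeP n = subst (λ m → Eval setCodeP (n ∷ []) (f (setCode m))) (prefix-self n)
    (ev-comp (ev-proj ∷ ev-proj ∷ []) (eval-prefixP n n))

  setWithBitP : PR 2
  setWithBitP = comp ifP (proj (suc zero)
                        ∷ comp toggleP (proj zero ∷ constP (f 0) ∷ [])
                        ∷ constP (f 0) ∷ [])

  eval-setWithBitP : ∀ i a → Eval setWithBitP (i ∷ bitℕ a ∷ []) (f (setCode (setWithBit i a)))
  eval-setWithBitP i a = subst (Eval _ _) (sym (if-float (f ∘ setCode) a))
    (ev-comp (ev-proj
            ∷ ev-comp (ev-proj ∷ eval-constP (f 0) ∷ []) (eval-toggleP i 0)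
            ∷ eval-constP (f 0) ∷ [])
      (eval-ifP a _ _))

  pairCodeP : PR 2
  pairCodeP = comp (searchP (proj₁ cD)) (proj zero ∷ setWithBitP ∷ [])

  eval-pairCodeP : ∀ i a → Eval pairCodeP (i ∷ bitℕ a ∷ []) (f (pairCode i a))
  eval-pairCodeP i a = ev-comp (ev-proj ∷ eval-setWithBitP i a ∷ [])
    (eval-searchP-along cD surjective preserves-D (λ {i} → HD-functional {i})
      (subst (HD i (setCode (setWithBit i a)) ∘ pairCode i) (testBit-setWithBit i a)
        (HD-testBit (setWithBit i a) i)))

  fP : PR 1
  fP = comp ifP (parityP
               ∷ comp pairCodeP (comp halfP (halfP ∷ []) ∷ comp parityP (halfP ∷ []) ∷ [])
               ∷ comp setCodeP (halfP ∷ [])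
               ∷ [])

  eval-fP : ∀ n → Eval fP (n ∷ []) (f n)
  eval-fP n =
    subst (Eval fP (n ∷ [])) (trans (sym (if-float f (parity n))) (cong f (sym (n≡pairCode-or-setCode n))))
      (ev-comp (eval-parityP n
              ∷ ev-comp (ev-comp (eval-halfP n ∷ []) (eval-halfP (half n))
                       ∷ ev-comp (eval-halfP n ∷ []) (eval-parityP (half n)) ∷ [])
                  (eval-pairCodeP (half (half n)) (parity (half n)))
              ∷ ev-comp (eval-halfP n ∷ []) (eval-setCodeP (half n))
              ∷ [])
        (eval-ifP (parity n) _ _))

proposition3p10 : (𝒢 : Structure) → ComputableStructure 𝒢 →
    (f : ℕ → ℕ) → IsIso ℋ 𝒢 f → Computable f
proposition3p10 𝒢 (cD , cE) f iso = fP , eval-fP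
  where open Reconstruction 𝒢 cD cE f iso
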